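{- Let $n$ be an even positive integer and $k$ an integer with $1 \le k \le n-1$. If a positive divisor $d$ of $n$ satisfies $\gcd(k, n/d) > 1$, then $\alpha^k_d = 0$ and $\beta^k_d = 0$.
   Context: For a permutation $A = a_1\cdots a_n$ of $[n]=\{1,\dots,n\}$, an ascent is an index $i$ with $a_i<a_{i+1}$; $A$ is even/odd according to the parity of its number of inversions (pairs $i<j$ with $a_i>a_j$). A permutation is parity-alternate (a PAP) if its consecutive entries alternate between even and odd integers. The operator $\sigma$ on permutations of $[n]$ is defined as follows: (i) if $a_i = n$ for some $2\le i\le n-1$, then $\sigma(a_1\cdots a_n) = b_1\cdots b_n$ with $b_j = a_j+1$ for $a_j<n$ and $b_i = 1$; (ii) $\sigma(a_1\cdots a_{n-1}n) = 1\,(a_1+1)\cdots(a_{n-1}+1)$; (iii) $\sigma(n\,a_1\cdots a_{n-1}) = (a_1+1)\cdots(a_{n-1}+1)\,1$. $\sigma^\ell$ denotes $\ell$-fold iteration. For $n$ even, call a PAP $A = a_1\cdots a_{n-1}n$ of $[n]$ with $k$ ascents and last entry $n$ a canonical PAP with $k$ ascents, and define $\tau A = \sigma^{\,n-a_{n-1}}A$; $\tau$ maps canonical PAPs with $k$ ascents to canonical PAPs with $k$ ascents of the same parity, and $\tau^n A = A$. Let $\alpha^k_d$ be the number of orbits of size (period) $d$ of $\tau$ acting on the set of even canonical PAPs of $[n]$ with $k$ ascents, and $\beta^k_d$ the number of orbits of size $d$ of $\tau$ acting on the set of odd canonical PAPs of $[n]$ with $k$ ascents. -}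

module Defs where

open import Data.Bool using (Bool; true; false; if_then_else_; _∧_; not)
open import Data.Nat using (ℕ; zero; suc; _+_; _*_; _∸_; _<ᵇ_; _≡ᵇ_; _%_)
open import Data.List using (List; []; _∷_; _++_; map; concatMap; length; filterᵇ; upTo; [_])

-- Permutations of [n] are represented as lists a₁ ⋯ aₙ of natural numbers.

range1 : ℕ → List ℕ
range1 n = map suc (upTo n)

insertAll : ℕ → List ℕ → List (List ℕ)
insertAll x [] = [ x ∷ [] ]
insertAll x (y ∷ ys) = (x ∷ y ∷ ys) ∷ map (y ∷_) (insertAll x ys)

perms : List ℕ → List (List ℕ)
perms [] = [ [] ]
perms (x ∷ xs) = concatMap (insertAll x) (perms xs)

permsOf : ℕ → List (List ℕ)
permsOf n = perms (range1 n)

ascents : List ℕ → ℕ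
ascents (x ∷ y ∷ r) = (if x <ᵇ y then 1 else 0) + ascents (y ∷ r)
ascents _ = 0

inversions : List ℕ → ℕ
inversions [] = 0
inversions (x ∷ r) = length (filterᵇ (λ y → y <ᵇ x) r) + inversions r

isEvenℕ : ℕ → Bool
isEvenℕ m = m % 2 ≡ᵇ 0

isEvenPerm : List ℕ → Bool
isEvenPerm A = isEvenℕ (inversions A)

isPAP : List ℕ → Bool
isPAP (x ∷ y ∷ r) = not (isEvenℕ x ≡ᵇB isEvenℕ y) ∧ isPAP (y ∷ r)
  where
  _≡ᵇB_ : Bool → Bool → Bool
  true ≡ᵇB b = b
  false ≡ᵇB b = not b
isPAP _ = true

eqList : List ℕ → List ℕ → Bool
eqList [] [] = true
eqList (x ∷ xs) (y ∷ ys) = (x ≡ᵇ y) ∧ eqList xs ys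
eqList _ _ = false

lexLeq : List ℕ → List ℕ → Bool
lexLeq [] _ = true
lexLeq (x ∷ xs) [] = false
lexLeq (x ∷ xs) (y ∷ ys) = if x <ᵇ y then true else ((x ≡ᵇ y) ∧ lexLeq xs ys)

headIs : ℕ → List ℕ → Bool
headIs n [] = false
headIs n (x ∷ _) = x ≡ᵇ n

lastIs : ℕ → List ℕ → Bool
lastIs n [] = false
lastIs n (x ∷ []) = x ≡ᵇ n
lastIs n (_ ∷ y ∷ r) = lastIs n (y ∷ r)

initL : List ℕ → List ℕ
initL [] = []
initL (x ∷ []) = []
initL (x ∷ y ∷ r) = x ∷ initL (y ∷ r)

-- the entry a_{n-1} (second to last); 0 if the list is too short
secondLast : List ℕ → ℕ
secondLast (x ∷ y ∷ []) = x
secondLast (x ∷ y ∷ z ∷ r) = secondLast (y ∷ z ∷ r)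
secondLast _ = 0

σ : ℕ → List ℕ → List ℕ
σ n [] = []
σ n (a ∷ as) =
  if a ≡ᵇ n then map suc as ++ [ 1 ]
  else if lastIs n (a ∷ as) then 1 ∷ map suc (initL (a ∷ as))
  else map (λ b → if b ≡ᵇ n then 1 else suc b) (a ∷ as)

iter : (List ℕ → List ℕ) → ℕ → List ℕ → List ℕ
iter f zero A = A
iter f (suc l) A = f (iter f l A)

τ : ℕ → List ℕ → List ℕ
τ n A = iter (σ n) (n ∸ secondLast A) A

-- canonical PAPs of [n] with k ascents and given parity (true = even)
canonicalPAPs : ℕ → ℕ → Bool → List (List ℕ)
canonicalPAPs n k par =
  filterᵇ (λ A → isPAP A ∧ lastIs n A ∧ (ascents A ≡ᵇ k) ∧ (isEvenPerm A ≡ᵇB par))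
          (permsOf n)
  where
  _≡ᵇB_ : Bool → Bool → Bool
  true ≡ᵇB b = b
  false ≡ᵇB b = not b

allB : (ℕ → Bool) → List ℕ → Bool
allB p [] = true
allB p (x ∷ xs) = p x ∧ allB p xs

hasPeriod : ℕ → ℕ → List ℕ → Bool
hasPeriod n zero A = false
hasPeriod n (suc d') A =
  eqList (iter (τ n) (suc d') A) A ∧ allB (λ l → not (eqList (iter (τ n) (suc l) A) A)) (upTo d')

-- A is the lexicographically least element of its τ-orbit {τ^j A : j < n}
-- (τ^n = id, so this is the whole orbit); used to count each orbit once
isOrbitRep : ℕ → List ℕ → Bool
isOrbitRep n A = allB (λ j → lexLeq A (iter (τ n) j A)) (upTo n)

orbitCount : ℕ → ℕ → Bool → ℕ → ℕ
orbitCount n k par d =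
  length (filterᵇ (λ A → hasPeriod n d A ∧ isOrbitRep n A) (canonicalPAPs n k par))

α : ℕ → ℕ → ℕ → ℕ
α n k d = orbitCount n k true d

β : ℕ → ℕ → ℕ → ℕ
β n k d = orbitCount n k false d

module Submission where

open import Defs
open import Data.Bool using (true; false; if_then_else_; _∧_; T)
open import Data.Bool.Properties using (T-∧)
open import Data.Empty using (⊥-elim)
open import Data.List using (List; []; _∷_; _++_; _∷ʳ_; map; length; upTo; initLast; _∷ʳ′_)
open import Data.List.Properties using (length-++; length-map; length-upTo; map-++; map-∘; map-cong-local; filter-none)
open import Data.List.Relation.Unary.All using (All; []; _∷_)
import Data.List.Relation.Unary.All as All
open import Data.List.Relation.Unary.All.Properties
  using (++⁻ˡ; ++⁻ʳ; ∷ʳ⁻; map⁺; gmap⁺; concat⁺; applyUpTo⁺₁; all-filter; filter⁺)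
open import Data.List.Relation.Unary.AllPairs using ([]; _∷_)
open import Data.List.Relation.Unary.Unique.Propositional using (Unique)
open import Data.List.Relation.Unary.Unique.Propositional.Properties using (upTo⁺) renaming (map⁺ to Unique-map⁺)
open import Data.List.Relation.Binary.Permutation.Propositional
  using (_↭_; ↭-refl; ↭-prep; ↭-swap; ↭-trans; ↭-sym; ↭⇒↭ₛ)
open import Data.List.Relation.Binary.Permutation.Propositional.Properties using (All-resp-↭; ↭-length)
open import Data.Nat
open import Data.Nat.Coprimality using (Coprime)
open import Data.Nat.Divisibility using (_∣_; divides; ∣m+n∣m⇒∣n; ∣m⇒∣m*n)
open import Data.Nat.DivMod
open import Data.Nat.GCD using (gcd; gcd[m,n]∣m; gcd[m,n]∣n)
open import Data.Nat.Properties
open import Data.Nat.Tactic.RingSolver using (solve-∀)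
open import Data.Product using (_×_; _,_; proj₁; proj₂; ∃-syntax)
open import Data.Sum using (_⊎_; inj₁; inj₂)
open import Function using (id)
open import Function.Bundles using (Equivalence)
open import Relation.Binary.PropositionalEquality
open import Relation.Nullary using (¬_)
open import Relation.Nullary.Decidable using (dec-true; dec-false)
open import Data.List.Relation.Binary.Permutation.Setoid.Properties (setoid ℕ) using ()
  renaming (Unique-resp-↭ to Unique-resp-↭ₛ)

-- Read a canonical permutation A = a₁ ⋯ aₙ₋₁ n cyclically as a word r over ℤ/n, r j = a_(j mod n) mod n,
-- so that the final n becomes 0. One application of τ rotates this word by one place and adds a
-- constant to every letter; hence τ^d A = A gives r (j + d) ≡ r j + S (mod n). The forward gaps
-- r (j + 1) − r j (mod n) add up to n c around the cycle, where c = n − k is the number of cyclic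
-- descents, and they are d-periodic, so one period contributes d c and S ≡ d c. If g divides k and
-- q = n / d then g divides c, and r ((q / g) d) ≡ r 0 + (q / g) d c ≡ r 0; since the letters of r
-- are distinct, g = 1.

-- Finite sums

sumTo : ℕ → (ℕ → ℕ) → ℕ
sumTo zero    f = 0
sumTo (suc a) f = sumTo a f + f a

sumTo-cong : ∀ a {f g : ℕ → ℕ} → (∀ j → j < a → f j ≡ g j) → sumTo a f ≡ sumTo a g
sumTo-cong zero    f≗g = refl
sumTo-cong (suc a) f≗g = cong₂ _+_ (sumTo-cong a (λ j j<a → f≗g j (m<n⇒m<1+n j<a))) (f≗g a ≤-refl)

sumTo-+ : ∀ a b (f : ℕ → ℕ) → sumTo (a + b) f ≡ sumTo a f + sumTo b (λ j → f (a + j))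
sumTo-+ a zero    f = trans (cong (λ c → sumTo c f) (+-identityʳ a)) (sym (+-identityʳ _))
sumTo-+ a (suc b) f = begin
  sumTo (a + suc b) f                              ≡⟨ cong (λ c → sumTo c f) (+-suc a b) ⟩
  sumTo (a + b) f + f (a + b)                      ≡⟨ cong (_+ f (a + b)) (sumTo-+ a b f) ⟩
  sumTo a f + sumTo b (λ j → f (a + j)) + f (a + b) ≡⟨ +-assoc (sumTo a f) _ _ ⟩
  sumTo a f + sumTo (suc b) (λ j → f (a + j))      ∎
  where open ≡-Reasoning

sumTo-periodic : ∀ q d (f : ℕ → ℕ) → (∀ j → f (j + d) ≡ f j) → sumTo (q * d) f ≡ q * sumTo d f
sumTo-periodic zero    d f f-per = refl
sumTo-periodic (suc q) d f f-per = begin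
  sumTo (d + q * d) f                          ≡⟨ sumTo-+ d (q * d) f ⟩
  sumTo d f + sumTo (q * d) (λ j → f (d + j))  ≡⟨ cong (sumTo d f +_) (sumTo-cong (q * d) λ j _ → trans (cong f (+-comm d j)) (f-per j)) ⟩
  sumTo d f + sumTo (q * d) f                  ≡⟨ cong (sumTo d f +_) (sumTo-periodic q d f f-per) ⟩
  sumTo d f + q * sumTo d f                    ∎
  where open ≡-Reasoning

-- Arithmetic on the cycle ℤ/n

wrap : ℕ → ℕ → ℕ
wrap x y = if y <ᵇ x then 1 else 0

wrap-cases : ∀ x y → (y < x × wrap x y ≡ 1) ⊎ (x ≤ y × wrap x y ≡ 0)
wrap-cases x y with y <ᵇ x in eq
... | true  = inj₁ (<ᵇ⇒< y x (subst T (sym eq) _) , refl)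
... | false = inj₂ (≮⇒≥ (λ y<x → subst T eq (<⇒<ᵇ y<x)) , refl)

module Modular (n : ℕ) .{{_ : NonZero n}} where

  [m%n+o]%n≡[m+o]%n : ∀ x y → (x % n + y) % n ≡ (x + y) % n
  [m%n+o]%n≡[m+o]%n x y = begin
    (x % n + y) % n           ≡⟨ %-distribˡ-+ (x % n) y n ⟩
    (x % n % n + y % n) % n   ≡⟨ cong (λ z → (z + y % n) % n) (m%n%n≡m%n x n) ⟩
    (x % n + y % n) % n       ≡⟨ %-distribˡ-+ x y n ⟨
    (x + y) % n               ∎
    where open ≡-Reasoning

  [m+o%n]%n≡[m+o]%n : ∀ x y → (x + y % n) % n ≡ (x + y) % n
  [m+o%n]%n≡[m+o]%n x y = begin
    (x + y % n) % n  ≡⟨ cong (_% n) (+-comm x (y % n)) ⟩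
    (y % n + x) % n  ≡⟨ [m%n+o]%n≡[m+o]%n y x ⟩
    (y + x) % n      ≡⟨ cong (_% n) (+-comm y x) ⟩
    (x + y) % n      ∎
    where open ≡-Reasoning

  %-cong-+ˡ : ∀ a {u v} → u % n ≡ v % n → (a + u) % n ≡ (a + v) % n
  %-cong-+ˡ a {u} {v} eq = begin
    (a + u) % n      ≡⟨ [m+o%n]%n≡[m+o]%n a u ⟨
    (a + u % n) % n  ≡⟨ cong (λ z → (a + z) % n) eq ⟩
    (a + v % n) % n  ≡⟨ [m+o%n]%n≡[m+o]%n a v ⟩
    (a + v) % n      ∎
    where open ≡-Reasoning

  %-cancel-+ˡ : ∀ a {u v} → (a + u) % n ≡ (a + v) % n → u % n ≡ v % n
  %-cancel-+ˡ a {u} {v} eq = trans (sym (undo u)) (trans (%-cong-+ˡ (n ∸ a % n) eq) (undo v))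
    where
    open ≡-Reasoning
    undo : ∀ w → ((n ∸ a % n) + (a + w)) % n ≡ w % n
    undo w = begin
      ((n ∸ a % n) + (a + w)) % n        ≡⟨ %-cong-+ˡ (n ∸ a % n) ([m%n+o]%n≡[m+o]%n a w) ⟨
      ((n ∸ a % n) + (a % n + w)) % n    ≡⟨ cong (_% n) (+-assoc (n ∸ a % n) (a % n) w) ⟨
      ((n ∸ a % n) + a % n + w) % n      ≡⟨ cong (λ z → (z + w) % n) (m∸n+n≡m (<⇒≤ (m%n<n a n))) ⟩
      (n + w) % n                        ≡⟨ cong (_% n) (+-comm n w) ⟩
      (w + n) % n                        ≡⟨ [m+n]%n≡m%n w n ⟩
      w % n                              ∎

  %-injective-< : ∀ {u v} → u < n → v < n → u % n ≡ v % n → u ≡ v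
  %-injective-< u<n v<n eq = trans (sym (m<n⇒m%n≡m u<n)) (trans eq (m<n⇒m%n≡m v<n))

  [m+kn]%n≡m : ∀ {x} k → x < n → (x + k * n) % n ≡ x
  [m+kn]%n≡m {x} k x<n = trans ([m+kn]%n≡m%n x k n) (m<n⇒m%n≡m x<n)

  -- The distance from x forward to y on the cycle ℤ/n.
  gap : ℕ → ℕ → ℕ
  gap x y = y + n * wrap x y ∸ x

  +-gap : ∀ {x} y → x < n → x + gap x y ≡ y + n * wrap x y
  +-gap {x} y x<n = m+[n∸m]≡n x≤
    where
    x≤ : x ≤ y + n * wrap x y
    x≤ with wrap-cases x y
    ... | inj₁ (_ , w≡1)   rewrite w≡1 | *-identityʳ n = ≤-trans (<⇒≤ x<n) (m≤n+m n y)
    ... | inj₂ (x≤y , w≡0) rewrite w≡0 = ≤-trans x≤y (m≤m+n y (n * 0))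

  gap<n : ∀ {x y} → x < n → y < n → gap x y < n
  gap<n {x} {y} x<n y<n with wrap-cases x y
  ... | inj₁ (y<x , w≡1) rewrite w≡1 | *-identityʳ n = +-cancelˡ-< x _ _ (begin-strict
        x + (y + n ∸ x) ≡⟨ m+[n∸m]≡n (≤-trans (<⇒≤ x<n) (m≤n+m n y)) ⟩
        y + n           <⟨ +-monoˡ-< n y<x ⟩
        x + n           ∎)
    where open ≤-Reasoning
  ... | inj₂ (_ , w≡0) rewrite w≡0 | *-zeroʳ n | +-identityʳ y = ≤-<-trans (m∸n≤m y x) y<n

  +-gap-% : ∀ {x y} → x < n → y < n → (x + gap x y) % n ≡ y
  +-gap-% {x} {y} x<n y<n = begin
    (x + gap x y) % n         ≡⟨ cong (_% n) (+-gap y x<n) ⟩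
    (y + n * wrap x y) % n    ≡⟨ cong (λ z → (y + z) % n) (*-comm n (wrap x y)) ⟩
    (y + wrap x y * n) % n    ≡⟨ [m+kn]%n≡m (wrap x y) y<n ⟩
    y                         ∎
    where open ≡-Reasoning

  gap-translate : ∀ {x y} S → x < n → y < n → gap ((x + S) % n) ((y + S) % n) ≡ gap x y
  gap-translate {x} {y} S x<n y<n =
    %-injective-< (gap<n x'<n y'<n) (gap<n x<n y<n) (%-cancel-+ˡ x' (begin
      (x' + gap x' y') % n        ≡⟨ +-gap-% x'<n y'<n ⟩
      (y + S) % n                 ≡⟨ cong (λ z → (z + S) % n) (+-gap-% x<n y<n) ⟨
      ((x + gap x y) % n + S) % n ≡⟨ [m%n+o]%n≡[m+o]%n (x + gap x y) S ⟩
      (x + gap x y + S) % n       ≡⟨ cong (_% n) (x+g+S≡x+S+g x (gap x y) S) ⟩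
      (x + S + gap x y) % n       ≡⟨ [m%n+o]%n≡[m+o]%n (x + S) (gap x y) ⟨
      (x' + gap x y) % n          ∎))
    where
    open ≡-Reasoning
    x' = (x + S) % n
    y' = (y + S) % n
    x'<n = m%n<n (x + S) n
    y'<n = m%n<n (y + S) n
    x+g+S≡x+S+g : ∀ a b c → a + b + c ≡ a + c + b
    x+g+S≡x+S+g = solve-∀

-- Cyclic words over ℤ/n with a rotational symmetry

cyclicDescentsOf : ℕ → (ℕ → ℕ) → ℕ
cyclicDescentsOf n r = sumTo n (λ j → wrap (r j) (r (suc j)))

module CyclicSequence (n : ℕ) .{{n≢0 : NonZero n}} (r : ℕ → ℕ) (r<n : ∀ j → r j < n) (closed : r n ≡ r 0) where

  open Modular n

  gaps : ℕ → ℕ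
  gaps j = gap (r j) (r (suc j))

  wraps : ℕ → ℕ
  wraps j = wrap (r j) (r (suc j))

  cyclicDescents : ℕ
  cyclicDescents = cyclicDescentsOf n r

  r+Σgaps : ∀ a → r 0 + sumTo a gaps ≡ r a + n * sumTo a wraps
  r+Σgaps zero = trans (+-identityʳ (r 0)) (sym (trans (cong (r 0 +_) (*-zeroʳ n)) (+-identityʳ (r 0))))
  r+Σgaps (suc a) = begin
    r 0 + (sumTo a gaps + gaps a)                  ≡⟨ +-assoc (r 0) _ _ ⟨
    r 0 + sumTo a gaps + gaps a                    ≡⟨ cong (_+ gaps a) (r+Σgaps a) ⟩
    r a + n * sumTo a wraps + gaps a               ≡⟨ shuffle (r a) (n * sumTo a wraps) (gaps a) ⟩
    r a + gaps a + n * sumTo a wraps               ≡⟨ cong (_+ n * sumTo a wraps) (+-gap (r (suc a)) (r<n a)) ⟩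
    r (suc a) + n * wraps a + n * sumTo a wraps    ≡⟨ +-assoc (r (suc a)) _ _ ⟩
    r (suc a) + (n * wraps a + n * sumTo a wraps)  ≡⟨ cong (r (suc a) +_) (*-distribˡ-+ n (wraps a) _) ⟨
    r (suc a) + n * (wraps a + sumTo a wraps)      ≡⟨ cong (λ z → r (suc a) + n * z) (+-comm (wraps a) _) ⟩
    r (suc a) + n * (sumTo a wraps + wraps a)      ∎
    where
    open ≡-Reasoning
    shuffle : ∀ x y z → x + y + z ≡ x + z + y
    shuffle = solve-∀

  Σgaps≡n*cyclicDescents : sumTo n gaps ≡ n * cyclicDescents
  Σgaps≡n*cyclicDescents = +-cancelˡ-≡ (r 0) _ _ (trans (r+Σgaps n) (cong (_+ n * cyclicDescents) closed))

  module _ {d q S : ℕ} (qd≡n : q * d ≡ n) (rotate : ∀ j → r (j + d) ≡ (r j + S) % n) where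

    gaps-periodic : ∀ j → gaps (j + d) ≡ gaps j
    gaps-periodic j rewrite rotate j | rotate (suc j) = gap-translate S (r<n j) (r<n (suc j))

    Σgaps-period : sumTo d gaps ≡ d * cyclicDescents
    Σgaps-period = *-cancelˡ-≡ _ _ q {{q≢0}} (begin
      q * sumTo d gaps        ≡⟨ sumTo-periodic q d gaps gaps-periodic ⟨
      sumTo (q * d) gaps      ≡⟨ cong (λ z → sumTo z gaps) qd≡n ⟩
      sumTo n gaps            ≡⟨ Σgaps≡n*cyclicDescents ⟩
      n * cyclicDescents      ≡⟨ cong (_* cyclicDescents) qd≡n ⟨
      q * d * cyclicDescents  ≡⟨ *-assoc q d cyclicDescents ⟩
      q * (d * cyclicDescents) ∎)
      where
      open ≡-Reasoning
      q≢0 : NonZero q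
      q≢0 = m*n≢0⇒m≢0 q {{subst NonZero (sym qd≡n) n≢0}}

    rotate-by-Σgaps : ∀ j → r (j + d) ≡ (r j + sumTo d gaps) % n
    rotate-by-Σgaps j = begin
      r (j + d)                   ≡⟨ rotate j ⟩
      (r j + S) % n               ≡⟨ %-cong-+ˡ (r j) S≡Σgaps ⟩
      (r j + sumTo d gaps) % n    ∎
      where
      open ≡-Reasoning
      S≡Σgaps : S % n ≡ sumTo d gaps % n
      S≡Σgaps = %-cancel-+ˡ (r 0) (begin
        (r 0 + S) % n                        ≡⟨ rotate 0 ⟨
        r d                                  ≡⟨ [m+kn]%n≡m (sumTo d wraps) (r<n d) ⟨
        (r d + sumTo d wraps * n) % n        ≡⟨ cong (λ z → (r d + z) % n) (*-comm (sumTo d wraps) n) ⟩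
        (r d + n * sumTo d wraps) % n        ≡⟨ cong (_% n) (r+Σgaps d) ⟨
        (r 0 + sumTo d gaps) % n             ∎)

    r[i*d] : ∀ i → r (i * d) ≡ (r 0 + i * (d * cyclicDescents)) % n
    r[i*d] zero = sym (trans (cong (_% n) (+-identityʳ (r 0))) (m<n⇒m%n≡m (r<n 0)))
    r[i*d] (suc i) = begin
      r (d + i * d)                        ≡⟨ cong r (+-comm d (i * d)) ⟩
      r (i * d + d)                        ≡⟨ rotate-by-Σgaps (i * d) ⟩
      (r (i * d) + B) % n                  ≡⟨ cong (λ z → (z + B) % n) (r[i*d] i) ⟩
      ((r 0 + i * dc) % n + B) % n         ≡⟨ [m%n+o]%n≡[m+o]%n (r 0 + i * dc) B ⟩
      (r 0 + i * dc + B) % n               ≡⟨ cong (λ z → (r 0 + i * dc + z) % n) Σgaps-period ⟩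
      (r 0 + i * dc + dc) % n              ≡⟨ cong (_% n) (shuffle (r 0) (i * dc) dc) ⟩
      (r 0 + (dc + i * dc)) % n            ∎
      where
      open ≡-Reasoning
      B = sumTo d gaps
      dc = d * cyclicDescents
      shuffle : ∀ x y z → x + y + z ≡ x + (z + y)
      shuffle = solve-∀

    -- For a common divisor g of q and cyclicDescents, the index t = (q / g) d satisfies r t ≡ r 0,
    -- so injectivity forces t ≥ n = t g, i.e. g ≤ 1.
    rotation-coprime : (∀ i j → i < n → j < n → r i ≡ r j → i ≡ j) → Coprime q cyclicDescents
    rotation-coprime r-injective {g} (divides q′ q≡q′g , divides c′ c≡c′g) =
      sym (≤∧≮⇒≡ (n≢0⇒n>0 g≢0) g≯1)
      where
      open ≡-Reasoning
      t = q′ * d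
      n≡t*g : n ≡ t * g
      n≡t*g = begin
        n              ≡⟨ qd≡n ⟨
        q * d          ≡⟨ cong (_* d) q≡q′g ⟩
        q′ * g * d     ≡⟨ shuffle q′ g d ⟩
        q′ * d * g     ∎
        where
        shuffle : ∀ x y z → x * y * z ≡ x * z * y
        shuffle = solve-∀
      r[t]≡r[0] : r t ≡ r 0
      r[t]≡r[0] = begin
        r (q′ * d)                                ≡⟨ r[i*d] q′ ⟩
        (r 0 + q′ * (d * cyclicDescents)) % n     ≡⟨ cong (λ z → (r 0 + q′ * (d * z)) % n) c≡c′g ⟩
        (r 0 + q′ * (d * (c′ * g))) % n           ≡⟨ cong (λ z → (r 0 + z) % n) (shuffle q′ d c′ g) ⟩
        (r 0 + c′ * (q′ * d * g)) % n             ≡⟨ cong (λ z → (r 0 + c′ * z) % n) n≡t*g ⟨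
        (r 0 + c′ * n) % n                        ≡⟨ [m+kn]%n≡m c′ (r<n 0) ⟩
        r 0                                       ∎
        where
        shuffle : ∀ x y z w → x * (y * (z * w)) ≡ z * (x * y * w)
        shuffle = solve-∀
      n≢0′ : n ≢ 0
      n≢0′ = ≢-nonZero⁻¹ n {{n≢0}}
      t≢0 : t ≢ 0
      t≢0 t≡0 = n≢0′ (trans n≡t*g (cong (_* g) t≡0))
      g≢0 : g ≢ 0
      g≢0 g≡0 = n≢0′ (trans n≡t*g (trans (cong (t *_) g≡0) (*-zeroʳ t)))
      g≯1 : ¬ 1 < g
      g≯1 1<g = t≢0 (r-injective t 0 t<n (>-nonZero⁻¹ n {{n≢0}}) r[t]≡r[0])
        where
        t<n : t < n
        t<n = subst (t <_) (sym n≡t*g) (m<m*n t g {{≢-nonZero t≢0}} 1<g)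

-- Lists and permutations

nth : List ℕ → ℕ → ℕ
nth []       j       = 0
nth (x ∷ xs) zero    = x
nth (x ∷ xs) (suc j) = nth xs j

All-nth : ∀ {P : ℕ → Set} {xs} j → All P xs → j < length xs → P (nth xs j)
All-nth zero    (px ∷ _)  _         = px
All-nth (suc j) (_ ∷ pxs) (s≤s j<) = All-nth j pxs j<

nth-++ˡ : ∀ xs ys {j} → j < length xs → nth (xs ++ ys) j ≡ nth xs j
nth-++ˡ (x ∷ xs) ys {zero}  _        = refl
nth-++ˡ (x ∷ xs) ys {suc j} (s≤s j<) = nth-++ˡ xs ys j<

nth-∷ʳ-length : ∀ xs y → nth (xs ∷ʳ y) (length xs) ≡ y
nth-∷ʳ-length []       y = refl
nth-∷ʳ-length (x ∷ xs) y = nth-∷ʳ-length xs y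

nth-map : ∀ (f : ℕ → ℕ) xs {j} → j < length xs → nth (map f xs) j ≡ f (nth xs j)
nth-map f (x ∷ xs) {zero}  _        = refl
nth-map f (x ∷ xs) {suc j} (s≤s j<) = nth-map f xs j<

nth-injective : ∀ {xs} i j → Unique xs → i < length xs → j < length xs → nth xs i ≡ nth xs j → i ≡ j
nth-injective zero    zero    _         _        _        _ = refl
nth-injective zero    (suc j) (x∉ ∷ _)  _        (s≤s j<) e = ⊥-elim (All-nth j x∉ j< e)
nth-injective (suc i) zero    (x∉ ∷ _)  (s≤s i<) _        e = ⊥-elim (All-nth i x∉ i< (sym e))
nth-injective (suc i) (suc j) (_ ∷ xs!) (s≤s i<) (s≤s j<) e = cong suc (nth-injective i j xs! i< j< e)

lastIs-∷ʳ : ∀ n xs y → lastIs n (xs ∷ʳ y) ≡ (y ≡ᵇ n)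
lastIs-∷ʳ n []           y = refl
lastIs-∷ʳ n (x ∷ [])     y = refl
lastIs-∷ʳ n (x ∷ x′ ∷ xs) y = lastIs-∷ʳ n (x′ ∷ xs) y

initL-∷ʳ : ∀ xs y → initL (xs ∷ʳ y) ≡ xs
initL-∷ʳ []           y = refl
initL-∷ʳ (x ∷ [])     y = refl
initL-∷ʳ (x ∷ x′ ∷ xs) y = cong (x ∷_) (initL-∷ʳ (x′ ∷ xs) y)

secondLast-∷ʳ : ∀ xs a b → secondLast (xs ∷ʳ a ∷ʳ b) ≡ a
secondLast-∷ʳ []                a b = refl
secondLast-∷ʳ (x ∷ [])          a b = refl
secondLast-∷ʳ (x ∷ x′ ∷ [])     a b = refl
secondLast-∷ʳ (x ∷ x′ ∷ x″ ∷ xs) a b = secondLast-∷ʳ (x′ ∷ x″ ∷ xs) a b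

lastIs⇒∷ʳ : ∀ n L → T (lastIs n L) → ∃[ I ] L ≡ I ∷ʳ n
lastIs⇒∷ʳ n L last≡n with initLast L
... | I ∷ʳ′ x rewrite lastIs-∷ʳ n I x | ≡ᵇ⇒≡ x n last≡n = I , refl

Unique-∷ʳ⁻ : ∀ (xs : List ℕ) y → Unique (xs ∷ʳ y) → Unique xs × All (_≢ y) xs
Unique-∷ʳ⁻ []       y _            = [] , []
Unique-∷ʳ⁻ (x ∷ xs) y (x∉ ∷ xs∷ʳy!) with Unique-∷ʳ⁻ xs y xs∷ʳy!
... | xs! , xs≢y = ++⁻ˡ xs x∉ ∷ xs! , All.head (++⁻ʳ xs x∉) ∷ xs≢y

insertAll-↭ : ∀ x ys → All (_↭ x ∷ ys) (insertAll x ys)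
insertAll-↭ x []       = ↭-refl ∷ []
insertAll-↭ x (y ∷ ys) = ↭-refl ∷ gmap⁺ (λ p → ↭-trans (↭-prep y p) (↭-swap y x ↭-refl)) (insertAll-↭ x ys)

perms-↭ : ∀ xs → All (_↭ xs) (perms xs)
perms-↭ []       = ↭-refl ∷ []
perms-↭ (x ∷ xs) = concat⁺ (gmap⁺ insertions-↭ (perms-↭ xs))
  where
  insertions-↭ : ∀ {ys} → ys ↭ xs → All (_↭ x ∷ xs) (insertAll x ys)
  insertions-↭ {ys} ys↭xs = All.map (λ p → ↭-trans p (↭-prep x ys↭xs)) (insertAll-↭ x ys)

Unique-resp-↭ : ∀ {xs ys : List ℕ} → xs ↭ ys → Unique xs → Unique ys
Unique-resp-↭ p = Unique-resp-↭ₛ (↭⇒↭ₛ p)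

ascent+wrap≡1 : ∀ {x y} → x ≢ y → (if x <ᵇ y then 1 else 0) + wrap x y ≡ 1
ascent+wrap≡1 {x} {y} x≢y with wrap-cases x y
... | inj₁ (y<x , w≡1) rewrite dec-false (x <? y) (<⇒≯ y<x) | w≡1 = refl
... | inj₂ (x≤y , w≡0) rewrite dec-true (x <? y) (≤∧≢⇒< x≤y x≢y) | w≡0 = refl

adjacentWraps : List ℕ → ℕ → ℕ
adjacentWraps xs j = wrap (nth xs j) (nth xs (suc j))

-- Every adjacent pair of x ∷ I is an ascent or a wrap, and the final step up to y is an ascent.
ascents-∷ʳ+wraps : ∀ y x I → All (_< y) (x ∷ I) → Unique (x ∷ I) →
                   ascents (x ∷ I ∷ʳ y) + sumTo (length I) (adjacentWraps (x ∷ I)) ≡ suc (length I)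
ascents-∷ʳ+wraps y x []      (x<y ∷ []) _ rewrite dec-true (x <? y) x<y = refl
ascents-∷ʳ+wraps y x (z ∷ I) (_ ∷ <y) ((x≢z ∷ _) ∷ z∷I!) = begin
  (ascent + ascents′) + sumTo (suc (length I)) (adjacentWraps (x ∷ z ∷ I))
    ≡⟨ cong ((ascent + ascents′) +_) (sumTo-+ 1 (length I) (adjacentWraps (x ∷ z ∷ I))) ⟩
  (ascent + ascents′) + (wrap x z + wraps′)  ≡⟨ shuffle ascent ascents′ (wrap x z) wraps′ ⟩
  (ascent + wrap x z) + (ascents′ + wraps′)  ≡⟨ cong₂ _+_ (ascent+wrap≡1 x≢z) (ascents-∷ʳ+wraps y z I <y z∷I!) ⟩
  suc (suc (length I))                       ∎
  where
  open ≡-Reasoning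
  ascent = if x <ᵇ z then 1 else 0
  ascents′ = ascents (z ∷ I ∷ʳ y)
  wraps′ = sumTo (length I) (adjacentWraps (z ∷ I))
  shuffle : ∀ a b c d → (a + b) + (c + d) ≡ (a + c) + (b + d)
  shuffle = solve-∀

-- τ on canonical permutations

module Canonical (m : ℕ) where

  n : ℕ
  n = suc m

  open Modular n

  Entry : ℕ → Set
  Entry x = 0 < x × x ≤ n

  ProperEntry : ℕ → Set
  ProperEntry x = 0 < x × x < n

  -- The successor on the cycle 1 → 2 → ⋯ → n → 1; case (i) of σ applies it entrywise.
  next : ℕ → ℕ
  next b = if b ≡ᵇ n then 1 else suc b

  next^ : ℕ → ℕ → ℕ
  next^ zero    x = x
  next^ (suc t) x = next (next^ t x)

  next-< : ∀ {x} → x < n → next x ≡ suc x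
  next-< {x} x<n rewrite dec-false (x ≟ n) (<⇒≢ x<n) = refl

  next-Entry : ∀ {x} → Entry x → Entry (next x)
  next-Entry {x} (_ , x≤n) with x ≡ᵇ n in eq
  ... | true  = s≤s z≤n , s≤s z≤n
  ... | false = s≤s z≤n , ≤∧≢⇒< x≤n (λ x≡n → subst T eq (≡⇒≡ᵇ x n x≡n))

  next-% : ∀ x → next x % n ≡ suc x % n
  next-% x with x ≡ᵇ n in eq
  ... | true  rewrite ≡ᵇ⇒≡ x n (subst T (sym eq) _) = sym ([m+n]%n≡m%n 1 n)
  ... | false = refl

  next^-Entry : ∀ t {x} → Entry x → Entry (next^ t x)
  next^-Entry zero    x∈ = x∈
  next^-Entry (suc t) x∈ = next-Entry (next^-Entry t x∈)

  next^-% : ∀ t x → next^ t x % n ≡ (x + t) % n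
  next^-% zero    x = cong (_% n) (sym (+-identityʳ x))
  next^-% (suc t) x = begin
    next (next^ t x) % n          ≡⟨ next-% (next^ t x) ⟩
    (1 + next^ t x) % n           ≡⟨ [m+o%n]%n≡[m+o]%n 1 (next^ t x) ⟨
    (1 + next^ t x % n) % n       ≡⟨ cong (λ z → (1 + z) % n) (next^-% t x) ⟩
    (1 + (x + t) % n) % n         ≡⟨ [m+o%n]%n≡[m+o]%n 1 (x + t) ⟩
    suc (x + t) % n               ≡⟨ cong (_% n) (+-suc x t) ⟨
    (x + suc t) % n               ∎
    where open ≡-Reasoning

  next^-small : ∀ t {x} → x + t ≤ n → next^ t x ≡ x + t
  next^-small zero    {x} _      = sym (+-identityʳ x)
  next^-small (suc t) {x} x+t<n = begin
    next (next^ t x)  ≡⟨ cong next (next^-small t (≤-trans (n≤1+n _) x+1+t≤n)) ⟩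
    next (x + t)      ≡⟨ next-< x+1+t≤n ⟩
    suc (x + t)       ≡⟨ +-suc x t ⟨
    x + suc t         ∎
    where
    open ≡-Reasoning
    x+1+t≤n : suc (x + t) ≤ n
    x+1+t≤n = subst (_≤ n) (+-suc x t) x+t<n

  ProperEntry⇒Entry : ∀ {x} → ProperEntry x → Entry x
  ProperEntry⇒Entry (0<x , x<n) = 0<x , <⇒≤ x<n

  ProperEntry-%≢0 : ∀ {x} → ProperEntry x → x % n ≢ 0
  ProperEntry-%≢0 (0<x , x<n) x%n≡0 = <⇒≢ 0<x (sym (trans (sym (m<n⇒m%n≡m x<n)) x%n≡0))

  Entry-%-injective : ∀ {x y} → Entry x → Entry y → x % n ≡ y % n → x ≡ y
  Entry-%-injective (0<x , x≤n) (0<y , y≤n) eq with m≤n⇒m<n∨m≡n x≤n | m≤n⇒m<n∨m≡n y≤n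
  ... | inj₁ x<n  | inj₁ y<n  = %-injective-< x<n y<n eq
  ... | inj₁ x<n  | inj₂ refl = ⊥-elim (ProperEntry-%≢0 (0<x , x<n) (trans eq (n%n≡0 n)))
  ... | inj₂ refl | inj₁ y<n  = ⊥-elim (ProperEntry-%≢0 (0<y , y<n) (trans (sym eq) (n%n≡0 n)))
  ... | inj₂ refl | inj₂ refl = refl

  next^-injective : ∀ t {x y} → Entry x → Entry y → next^ t x ≡ next^ t y → x ≡ y
  next^-injective t {x} {y} x∈ y∈ eq = Entry-%-injective x∈ y∈ (%-cancel-+ˡ t (begin
    (t + x) % n      ≡⟨ cong (_% n) (+-comm t x) ⟩
    (x + t) % n      ≡⟨ next^-% t x ⟨
    next^ t x % n    ≡⟨ cong (_% n) eq ⟩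
    next^ t y % n    ≡⟨ next^-% t y ⟩
    (y + t) % n      ≡⟨ cong (_% n) (+-comm y t) ⟩
    (t + y) % n      ∎))
    where open ≡-Reasoning

  σ-∷ʳn : ∀ x I → x < n → σ n ((x ∷ I) ∷ʳ n) ≡ 1 ∷ map suc (x ∷ I)
  σ-∷ʳn x I x<n rewrite dec-false (x ≟ n) (<⇒≢ x<n) | lastIs-∷ʳ n (x ∷ I) n | dec-true (n ≟ n) refl =
    cong (λ L → 1 ∷ map suc L) (initL-∷ʳ (x ∷ I) n)

  σ-next : ∀ x xs y → x < n → y < n → σ n (x ∷ xs ∷ʳ y) ≡ map next (x ∷ xs ∷ʳ y)
  σ-next x xs y x<n y<n rewrite dec-false (x ≟ n) (<⇒≢ x<n) | lastIs-∷ʳ n (x ∷ xs) y | dec-false (y ≟ n) (<⇒≢ y<n) = refl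

  σ^-∷ʳn : ∀ J a t → All ProperEntry (J ∷ʳ a) → 1 ≤ t → a + t ≤ n →
           iter (σ n) t (J ∷ʳ a ∷ʳ n) ≡ t ∷ map (next^ t) (J ∷ʳ a)
  σ^-∷ʳn J a 1 proper _ _ = begin
    σ n (J ∷ʳ a ∷ʳ n)         ≡⟨ σ-∷ʳn-nonempty J proper ⟩
    1 ∷ map suc (J ∷ʳ a)       ≡⟨ cong (1 ∷_) (map-cong-local (All.map (λ p → sym (next-< (proj₂ p))) proper)) ⟩
    1 ∷ map next (J ∷ʳ a)      ∎
    where
    open ≡-Reasoning
    σ-∷ʳn-nonempty : ∀ J → All ProperEntry (J ∷ʳ a) → σ n (J ∷ʳ a ∷ʳ n) ≡ 1 ∷ map suc (J ∷ʳ a)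
    σ-∷ʳn-nonempty []      (a∈ ∷ _) = σ-∷ʳn a [] (proj₂ a∈)
    σ-∷ʳn-nonempty (x ∷ J) (x∈ ∷ _) = σ-∷ʳn x (J ∷ʳ a) (proj₂ x∈)
  σ^-∷ʳn J a (suc (suc t)) proper _ a+t+2≤n = begin
    σ n (iter (σ n) (suc t) (J ∷ʳ a ∷ʳ n))      ≡⟨ cong (σ n) (σ^-∷ʳn J a (suc t) proper (s≤s z≤n) (<⇒≤ a+t+1<n)) ⟩
    σ n (suc t ∷ map f (J ∷ʳ a))                ≡⟨ cong (λ L → σ n (suc t ∷ L)) (map-++ f J (a ∷ [])) ⟩
    σ n (suc t ∷ map f J ∷ʳ f a)                ≡⟨ σ-next (suc t) (map f J) (f a) t+1<n fa<n ⟩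
    map next (suc t ∷ map f J ∷ʳ f a)           ≡⟨ cong (λ L → map next (suc t ∷ L)) (map-++ f J (a ∷ [])) ⟨
    next (suc t) ∷ map next (map f (J ∷ʳ a))    ≡⟨ cong₂ _∷_ (next-< t+1<n) (sym (map-∘ (J ∷ʳ a))) ⟩
    suc (suc t) ∷ map (next^ (suc (suc t))) (J ∷ʳ a) ∎
    where
    open ≡-Reasoning
    f = next^ (suc t)
    a+t+1<n : a + suc t < n
    a+t+1<n = subst (_≤ n) (+-suc a (suc t)) a+t+2≤n
    t+1<n : suc t < n
    t+1<n = ≤-<-trans (m≤n+m (suc t) a) a+t+1<n
    fa<n : f a < n
    fa<n = subst (_< n) (sym (next^-small (suc t) (<⇒≤ a+t+1<n))) a+t+1<n

  τ-∷ʳn : ∀ J a → All ProperEntry (J ∷ʳ a) → τ n (J ∷ʳ a ∷ʳ n) ≡ (n ∸ a) ∷ map (next^ (n ∸ a)) (J ∷ʳ a)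
  τ-∷ʳn J a proper rewrite secondLast-∷ʳ J a n =
    σ^-∷ʳn J a (n ∸ a) proper (m<n⇒0<n∸m a<n) (≤-reflexive (m+[n∸m]≡n (<⇒≤ a<n)))
    where
    a<n : a < n
    a<n = proj₂ (proj₂ (∷ʳ⁻ proper))

  record Arrangement (I : List ℕ) : Set where
    field
      length≡m : length I ≡ m
      proper   : All ProperEntry I
      unique   : Unique I

  module Rotation (J : List ℕ) (a : ℕ) (arr : Arrangement (J ∷ʳ a)) where

    open Arrangement arr

    s : ℕ
    s = n ∸ a

    J-proper : All ProperEntry J
    J-proper = proj₁ (∷ʳ⁻ proper)

    a-proper : ProperEntry a
    a-proper = proj₂ (∷ʳ⁻ proper)

    a<n : a < n
    a<n = proj₂ a-proper

    next^s[a]≡n : next^ s a ≡ n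
    next^s[a]≡n = trans (next^-small s (≤-reflexive a+s≡n)) a+s≡n
      where
      a+s≡n : a + s ≡ n
      a+s≡n = m+[n∸m]≡n (<⇒≤ a<n)

    rotation-∷ʳn : s ∷ map (next^ s) (J ∷ʳ a) ≡ (s ∷ map (next^ s) J) ∷ʳ n
    rotation-∷ʳn = begin
      s ∷ map (next^ s) (J ∷ʳ a)         ≡⟨ cong (s ∷_) (map-++ (next^ s) J (a ∷ [])) ⟩
      s ∷ map (next^ s) J ∷ʳ next^ s a   ≡⟨ cong (λ x → s ∷ map (next^ s) J ∷ʳ x) next^s[a]≡n ⟩
      s ∷ map (next^ s) J ∷ʳ n           ∎
      where open ≡-Reasoning

    τ-rotates : τ n (J ∷ʳ a ∷ʳ n) ≡ (s ∷ map (next^ s) J) ∷ʳ n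
    τ-rotates = trans (τ-∷ʳn J a proper) rotation-∷ʳn

    s-proper : ProperEntry s
    s-proper = m<n⇒0<n∸m a<n , ∸-monoʳ-< (proj₁ a-proper) (<⇒≤ a<n)

    next^s-injective : ∀ {x y} → ProperEntry x → ProperEntry y → next^ s x ≡ next^ s y → x ≡ y
    next^s-injective x∈ y∈ = next^-injective s (ProperEntry⇒Entry x∈) (ProperEntry⇒Entry y∈)

    J-unique : Unique J
    J-unique = proj₁ (Unique-∷ʳ⁻ J a unique)

    J≢a : All (_≢ a) J
    J≢a = proj₂ (Unique-∷ʳ⁻ J a unique)

    next^s-proper : ∀ {x} → ProperEntry x → x ≢ a → ProperEntry (next^ s x)
    next^s-proper x∈ x≢a with next^-Entry s (ProperEntry⇒Entry x∈)
    ... | 0<y , y≤n = 0<y , ≤∧≢⇒< y≤n (λ eq → x≢a (next^s-injective x∈ a-proper (trans eq (sym next^s[a]≡n))))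

    s≢next^s : ∀ {x} → ProperEntry x → s ≢ next^ s x
    s≢next^s {x} x∈ s≡ = ProperEntry-%≢0 x∈ (%-cancel-+ˡ s (begin
      (s + x) % n      ≡⟨ cong (_% n) (+-comm s x) ⟩
      (x + s) % n      ≡⟨ next^-% s x ⟨
      next^ s x % n    ≡⟨ cong (_% n) s≡ ⟨
      s % n            ≡⟨ cong (_% n) (+-identityʳ s) ⟨
      (s + 0) % n      ∎))
      where open ≡-Reasoning

    map-next^s-unique : ∀ {xs} → All ProperEntry xs → Unique xs → Unique (map (next^ s) xs)
    map-next^s-unique []          []          = []
    map-next^s-unique (x∈ ∷ xs∈) (x∉ ∷ xs!) =
      map⁺ (All.zipWith (λ (y∈ , x≢y) eq → x≢y (next^s-injective x∈ y∈ eq)) (xs∈ , x∉)) ∷ map-next^s-unique xs∈ xs!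

    rotation-arrangement : Arrangement (s ∷ map (next^ s) J)
    rotation-arrangement = record
      { length≡m = trans (cong suc (length-map (next^ s) J)) (trans (+-comm 1 (length J)) (trans (sym (length-++ J)) length≡m))
      ; proper   = s-proper ∷ map⁺ (All.zipWith (λ (x∈ , x≢a) → next^s-proper x∈ x≢a) (J-proper , J≢a))
      ; unique   = map⁺ (All.map s≢next^s J-proper) ∷ map-next^s-unique J-proper J-unique
      }

  -- L read cyclically as a word over ℤ/n: the entry n becomes 0.
  residues : List ℕ → ℕ → ℕ
  residues L j = nth L (j % n) % n

  residues-< : ∀ L j → residues L j < n
  residues-< L j = m%n<n (nth L (j % n)) n

  residues-closed : ∀ L → residues L n ≡ residues L 0
  residues-closed L = cong (λ i → nth L i % n) (n%n≡0 n)

  residues-injective : ∀ {L} → All Entry L → Unique L → length L ≡ n →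
                       ∀ i j → i < n → j < n → residues L i ≡ residues L j → i ≡ j
  residues-injective {L} entries unique |L|≡n i j i<n j<n eq =
    nth-injective i j unique i<|L| j<|L|
      (Entry-%-injective (All-nth i entries i<|L|) (All-nth j entries j<|L|) (begin
        nth L i % n        ≡⟨ cong (λ k → nth L k % n) (m<n⇒m%n≡m i<n) ⟨
        residues L i       ≡⟨ eq ⟩
        residues L j       ≡⟨ cong (λ k → nth L k % n) (m<n⇒m%n≡m j<n) ⟩
        nth L j % n        ∎))
    where
    open ≡-Reasoning
    i<|L| = subst (i <_) (sym |L|≡n) i<n
    j<|L| = subst (j <_) (sym |L|≡n) j<n

  residues-∷ʳn-< : ∀ {I} → All ProperEntry I → length I ≡ m → ∀ {j} → j < m → residues (I ∷ʳ n) j ≡ nth I j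
  residues-∷ʳn-< {I} proper |I|≡m {j} j<m = begin
    nth (I ∷ʳ n) (j % n) % n   ≡⟨ cong (λ i → nth (I ∷ʳ n) i % n) (m<n⇒m%n≡m (m<n⇒m<1+n j<m)) ⟩
    nth (I ∷ʳ n) j % n         ≡⟨ cong (_% n) (nth-++ˡ I (n ∷ []) j<|I|) ⟩
    nth I j % n                ≡⟨ m<n⇒m%n≡m (proj₂ (All-nth j proper j<|I|)) ⟩
    nth I j                    ∎
    where
    open ≡-Reasoning
    j<|I| = subst (j <_) (sym |I|≡m) j<m

  residues-∷ʳn-m : ∀ I → length I ≡ m → residues (I ∷ʳ n) m ≡ 0
  residues-∷ʳn-m I |I|≡m = begin
    nth (I ∷ʳ n) (m % n) % n   ≡⟨ cong (λ i → nth (I ∷ʳ n) i % n) (trans (m<n⇒m%n≡m ≤-refl) (sym |I|≡m)) ⟩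
    nth (I ∷ʳ n) (length I) % n ≡⟨ cong (_% n) (nth-∷ʳ-length I n) ⟩
    n % n                      ≡⟨ n%n≡0 n ⟩
    0                          ∎
    where open ≡-Reasoning

  residues-rotate : ∀ s I → length I ≡ m → ∀ j →
                    residues (s ∷ map (next^ s) I) (suc j) ≡ (residues (I ∷ʳ n) j + s) % n
  residues-rotate s I |I|≡m j with m≤n⇒m<n∨m≡n (≤-pred (m%n<n j n))
  ... | inj₁ t<m = begin
    nth (s ∷ map (next^ s) I) (suc j % n) % n  ≡⟨ cong (λ i → nth (s ∷ map (next^ s) I) i % n) suc-j%n≡suc-t ⟩
    nth (map (next^ s) I) t % n                ≡⟨ cong (_% n) (nth-map (next^ s) I t<|I|) ⟩
    next^ s (nth I t) % n                      ≡⟨ next^-% s (nth I t) ⟩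
    (nth I t + s) % n                          ≡⟨ cong (λ x → (x + s) % n) (nth-++ˡ I (n ∷ []) t<|I|) ⟨
    (nth (I ∷ʳ n) t + s) % n                   ≡⟨ [m%n+o]%n≡[m+o]%n (nth (I ∷ʳ n) t) s ⟨
    (nth (I ∷ʳ n) t % n + s) % n               ∎
    where
    open ≡-Reasoning
    t = j % n
    t<|I| : t < length I
    t<|I| = subst (t <_) (sym |I|≡m) t<m
    suc-j%n≡suc-t : suc j % n ≡ suc t
    suc-j%n≡suc-t = trans (sym ([m+o%n]%n≡[m+o]%n 1 j)) (m<n⇒m%n≡m (s≤s t<m))
  ... | inj₂ t≡m = begin
    nth (s ∷ map (next^ s) I) (suc j % n) % n  ≡⟨ cong (λ i → nth (s ∷ map (next^ s) I) i % n) suc-j%n≡0 ⟩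
    (0 + s) % n                                ≡⟨ cong (λ x → (x + s) % n) (n%n≡0 n) ⟨
    (n % n + s) % n                            ≡⟨ cong (λ x → (x % n + s) % n) nth[t]≡n ⟨
    (nth (I ∷ʳ n) (j % n) % n + s) % n         ∎
    where
    open ≡-Reasoning
    suc-j%n≡0 : suc j % n ≡ 0
    suc-j%n≡0 = trans (sym ([m+o%n]%n≡[m+o]%n 1 j)) (trans (cong (λ t → suc t % n) t≡m) (n%n≡0 n))
    nth[t]≡n : nth (I ∷ʳ n) (j % n) ≡ n
    nth[t]≡n = trans (cong (nth (I ∷ʳ n)) (trans t≡m (sym |I|≡m))) (nth-∷ʳ-length I n)

  τ-step : 1 ≤ m → ∀ {I} → Arrangement I → ∃[ I′ ] ∃[ s ]
           τ n (I ∷ʳ n) ≡ I′ ∷ʳ n × Arrangement I′ ×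
           (∀ j → residues (I′ ∷ʳ n) (suc j) ≡ (residues (I ∷ʳ n) j + s) % n)
  τ-step 1≤m {I} arr with initLast I
  ... | [] = ⊥-elim (<⇒≢ 1≤m (Arrangement.length≡m arr))
  ... | J ∷ʳ′ a = s ∷ map (next^ s) J , s , τ-rotates , rotation-arrangement , λ j →
    trans (cong (λ L → residues L (suc j)) (sym rotation-∷ʳn)) (residues-rotate s (J ∷ʳ a) (Arrangement.length≡m arr) j)
    where open Rotation J a arr

  τ-iterate : 1 ≤ m → ∀ {I} → Arrangement I → ∀ i → ∃[ I′ ] ∃[ S ]
              iter (τ n) i (I ∷ʳ n) ≡ I′ ∷ʳ n × Arrangement I′ ×
              (∀ j → residues (I′ ∷ʳ n) (j + i) ≡ (residues (I ∷ʳ n) j + S) % n)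
  τ-iterate 1≤m {I} arr zero = I , 0 , refl , arr , λ j → begin
    residues (I ∷ʳ n) (j + 0)          ≡⟨ cong (residues (I ∷ʳ n)) (+-identityʳ j) ⟩
    residues (I ∷ʳ n) j                ≡⟨ m<n⇒m%n≡m (residues-< (I ∷ʳ n) j) ⟨
    residues (I ∷ʳ n) j % n            ≡⟨ cong (_% n) (+-identityʳ (residues (I ∷ʳ n) j)) ⟨
    (residues (I ∷ʳ n) j + 0) % n      ∎
    where open ≡-Reasoning
  τ-iterate 1≤m {I} arr (suc i) with τ-iterate 1≤m arr i
  ... | I′ , S , iterate≡ , arr′ , shifted with τ-step 1≤m arr′
  ... | I″ , s , τ≡ , arr″ , shifted′ = I″ , S + s , trans (cong (τ n) iterate≡) τ≡ , arr″ , λ j → begin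
    residues (I″ ∷ʳ n) (j + suc i)     ≡⟨ cong (residues (I″ ∷ʳ n)) (+-suc j i) ⟩
    residues (I″ ∷ʳ n) (suc (j + i))   ≡⟨ shifted′ (j + i) ⟩
    (residues (I′ ∷ʳ n) (j + i) + s) % n ≡⟨ cong (λ x → (x + s) % n) (shifted j) ⟩
    ((r j + S) % n + s) % n            ≡⟨ [m%n+o]%n≡[m+o]%n (r j + S) s ⟩
    (r j + S + s) % n                  ≡⟨ cong (_% n) (+-assoc (r j) S s) ⟩
    (r j + (S + s)) % n                ∎
    where
    open ≡-Reasoning
    r = residues (I ∷ʳ n)

  -- The cyclic word has one wrap more than x ∷ I (from its last entry down to 0) and none from 0 back to x.
  ascents+cyclicDescents : 1 ≤ m → ∀ {I} → Arrangement I →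
                           ascents (I ∷ʳ n) + cyclicDescentsOf n (residues (I ∷ʳ n)) ≡ n
  ascents+cyclicDescents 1≤m {[]}    arr = ⊥-elim (<⇒≢ 1≤m (Arrangement.length≡m arr))
  ascents+cyclicDescents 1≤m {x ∷ I} arr = begin
    asc + sumTo n w                                   ≡⟨ cong (λ k → asc + sumTo k w) n≡2+|I| ⟩
    asc + (sumTo (length I) w + w (length I) + w m′)  ≡⟨ cong₂ (λ a b → asc + (a + b + w m′)) Σw≡W w[|I|]≡1 ⟩
    asc + (W + 1 + w m′)                              ≡⟨ cong (λ c → asc + (W + 1 + c)) w[m′]≡0 ⟩
    asc + (W + 1 + 0)                                 ≡⟨ shuffle asc W ⟩
    suc (asc + W)                                     ≡⟨ cong suc (ascents-∷ʳ+wraps n x I (All.map proj₂ proper) unique) ⟩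
    suc m′                                            ≡⟨ n≡2+|I| ⟨
    n                                                 ∎
    where
    open ≡-Reasoning
    open Arrangement arr
    asc = ascents (x ∷ I ∷ʳ n)
    W = sumTo (length I) (adjacentWraps (x ∷ I))
    r = residues (x ∷ I ∷ʳ n)
    w : ℕ → ℕ
    w j = wrap (r j) (r (suc j))
    m′ = suc (length I)
    n≡2+|I| : n ≡ suc m′
    n≡2+|I| = cong suc (sym length≡m)
    r[j]≡nth : ∀ {j} → j < m′ → r j ≡ nth (x ∷ I) j
    r[j]≡nth {j} j<m′ = residues-∷ʳn-< proper length≡m (subst (j <_) length≡m j<m′)
    r[m′]≡0 : r m′ ≡ 0
    r[m′]≡0 = trans (cong r length≡m) (residues-∷ʳn-m (x ∷ I) length≡m)
    Σw≡W : sumTo (length I) w ≡ W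
    Σw≡W = sumTo-cong (length I) (λ j j<|I| → cong₂ wrap (r[j]≡nth (m<n⇒m<1+n j<|I|)) (r[j]≡nth (s≤s j<|I|)))
    w[|I|]≡1 : w (length I) ≡ 1
    w[|I|]≡1 = trans (cong₂ wrap (r[j]≡nth ≤-refl) r[m′]≡0)
                     (cong (λ b → if b then 1 else 0) (dec-true (0 <? _) (proj₁ (All-nth (length I) proper ≤-refl))))
    w[m′]≡0 : w m′ ≡ 0
    w[m′]≡0 = cong (λ c → wrap c (r (suc m′))) r[m′]≡0
    shuffle : ∀ a b → a + (b + 1 + 0) ≡ suc (a + b)
    shuffle = solve-∀

  ↭range1⇒entries : ∀ {A} → A ↭ range1 n → All Entry A
  ↭range1⇒entries A↭ = All-resp-↭ (↭-sym A↭) (map⁺ (applyUpTo⁺₁ id n (λ i<n → z<s , i<n)))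

  ↭range1⇒unique : ∀ {A} → A ↭ range1 n → Unique A
  ↭range1⇒unique A↭ = Unique-resp-↭ (↭-sym A↭) (Unique-map⁺ suc-injective (upTo⁺ n))

  ↭range1⇒length : ∀ {A} → A ↭ range1 n → length A ≡ n
  ↭range1⇒length A↭ = trans (↭-length A↭) (trans (length-map suc (upTo n)) (length-upTo n))

  arrangement-of-permutation : ∀ {A} → A ↭ range1 n → T (lastIs n A) → ∃[ I ] A ≡ I ∷ʳ n × Arrangement I
  arrangement-of-permutation {A} A↭ last≡n with lastIs⇒∷ʳ n A last≡n
  ... | I , refl = I , refl , record
    { length≡m = suc-injective (trans (trans (+-comm 1 (length I)) (sym (length-++ I))) (↭range1⇒length A↭))
    ; proper   = All.zipWith (λ ((0<x , x≤n) , x≢n) → 0<x , ≤∧≢⇒< x≤n x≢n) (++⁻ˡ I (↭range1⇒entries A↭) , I≢n)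
    ; unique   = I!
    }
    where
    I! = proj₁ (Unique-∷ʳ⁻ I n (↭range1⇒unique A↭))
    I≢n = proj₂ (Unique-∷ʳ⁻ I n (↭range1⇒unique A↭))

  period-coprime : 1 ≤ m → ∀ {A d q} → A ↭ range1 n → T (lastIs n A) →
                   iter (τ n) d A ≡ A → q * d ≡ n → Coprime q (ascents A)
  period-coprime 1≤m {A} {d} {q} A↭ last≡n periodic qd≡n {g} (g∣q , g∣k)
    with arrangement-of-permutation A↭ last≡n
  ... | I , refl , arr with τ-iterate 1≤m arr d
  ... | I′ , S , iterate≡ , _ , shifted = rotation-coprime qd≡n rotate injective (g∣q , g∣c)
    where
    r = residues (I ∷ʳ n)
    open CyclicSequence n r (residues-< (I ∷ʳ n)) (residues-closed (I ∷ʳ n))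
    rotate : ∀ j → r (j + d) ≡ (r j + S) % n
    rotate j = trans (cong (λ L → residues L (j + d)) (trans (sym periodic) iterate≡)) (shifted j)
    injective : ∀ i j → i < n → j < n → r i ≡ r j → i ≡ j
    injective = residues-injective (↭range1⇒entries A↭) (↭range1⇒unique A↭) (↭range1⇒length A↭)
    g∣c : g ∣ cyclicDescents
    g∣c = ∣m+n∣m⇒∣n (subst (g ∣_) (trans qd≡n (sym (ascents+cyclicDescents 1≤m arr))) (∣m⇒∣m*n d g∣q)) g∣k

-- Counting orbits

T-∧⁻ : ∀ x {y} → T (x ∧ y) → T x × T y
T-∧⁻ x = Equivalence.to T-∧

eqList⇒≡ : ∀ xs ys → T (eqList xs ys) → xs ≡ ys
eqList⇒≡ []       []       _ = refl
eqList⇒≡ (x ∷ xs) (y ∷ ys) eq with T-∧⁻ (x ≡ᵇ y) eq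
... | x≡y , xs≡ys = cong₂ _∷_ (≡ᵇ⇒≡ x y x≡y) (eqList⇒≡ xs ys xs≡ys)

hasPeriod⇒periodic : ∀ n d A → T (hasPeriod n d A) → iter (τ n) d A ≡ A
hasPeriod⇒periodic n (suc d) A per = eqList⇒≡ _ A (proj₁ (T-∧⁻ (eqList (iter (τ n) (suc d) A) A) per))

orbitCount≡0 : ∀ n k par d →
               (∀ {A} → A ↭ range1 n → T (lastIs n A) → ascents A ≡ k → ¬ T (hasPeriod n d A)) →
               orbitCount n k par d ≡ 0
orbitCount≡0 n k par d aperiodic =
  cong length (filter-none _ (All.zipWith noOrbit (all-filter _ (permsOf n) , filter⁺ _ (perms-↭ (range1 n)))))
  where
  noOrbit : ∀ {A} → T (isPAP A ∧ lastIs n A ∧ (ascents A ≡ᵇ k) ∧ _) × A ↭ range1 n →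
            ¬ T (hasPeriod n d A ∧ isOrbitRep n A)
  noOrbit {A} (canonical , A↭) orbit =
    aperiodic A↭ last≡n (≡ᵇ⇒≡ (ascents A) k asc≡k) (proj₁ (T-∧⁻ (hasPeriod n d A) orbit))
    where
    last≡n∧… = proj₂ (T-∧⁻ (isPAP A) canonical)
    last≡n = proj₁ (T-∧⁻ (lastIs n A) last≡n∧…)
    asc≡k = proj₁ (T-∧⁻ (ascents A ≡ᵇ k) (proj₂ (T-∧⁻ (lastIs n A) last≡n∧…)))

theorem5p1 : (n k d : ℕ) → 2 ∣ n → 1 ≤ n → 1 ≤ k → k ≤ n ∸ 1 → 1 ≤ d →
    (q : ℕ) → n ≡ q * d → 1 < gcd k q →
    α n k d ≡ 0 × β n k d ≡ 0
theorem5p1 (suc m) k d _ _ 1≤k k≤m _ q n≡qd 1<gcd = no-orbits true , no-orbits false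
  where
  open Canonical m
  no-orbits : ∀ par → orbitCount n k par d ≡ 0
  no-orbits par = orbitCount≡0 n k par d λ A↭ last≡n asc≡k hasPeriod →
    <⇒≢ 1<gcd (sym (period-coprime (≤-trans 1≤k k≤m) A↭ last≡n (hasPeriod⇒periodic n d _ hasPeriod) (sym n≡qd)
                     (gcd[m,n]∣n k q , subst (gcd k q ∣_) (sym asc≡k) (gcd[m,n]∣m k q))))
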